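{- For every fixed integer $q\ge1$ there is a constant $c=c(q)>0$ such that the size Ramsey number of $\vec P_n$ with respect to $q+1$ colors in directed (non-simple) graphs is at least $c\,n^{2q}$; that is, every directed graph, in which antiparallel edges are allowed, having fewer than $c\,n^{2q}$ edges admits a coloring of its edges with $q+1$ colors containing no monochromatic directed path on $n$ vertices.
   Context: Here directed graphs are allowed to contain pairs of antiparallel edges $(u,v),(v,u)$ (but no loops and no parallel edges in the same direction). $\vec P_n$ denotes the directed path on $n$ vertices; a monochromatic directed path is one all of whose edges receive the same color. -}

module Defs where

open import Data.Nat using (ℕ; suc)
open import Data.Fin using (Fin; toℕ)
open import Data.Product using (_×_; _,_; Σ)
open import Data.List using (List; length)
open import Data.List.Membership.Propositional using (_∈_)
open import Data.List.Relation.Unary.All using (All)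
open import Data.List.Relation.Unary.Unique.Propositional using (Unique)
open import Relation.Binary.PropositionalEquality using (_≡_; _≢_)
open import Relation.Nullary using (¬_)
open import Function.Definitions using (Injective)

-- Antiparallel pairs (u,v),(v,u) are allowed; loops and parallel
-- edges in the same direction are not.
record Digraph : Set where
  field
    nV    : ℕ
    edges : List (Fin nV × Fin nV)
    noLoops : All (λ e → Data.Product.proj₁ e ≢ Data.Product.proj₂ e) edges
    noParallel : Unique edges
open Digraph public

∣E∣ : Digraph → ℕ
∣E∣ G = length (edges G)

-- An edge colouring with k colours assigns a colour to every ordered pair;
-- only the values on edges matter.
Colouring : Digraph → ℕ → Set
Colouring G k = Fin (nV G) → Fin (nV G) → Fin k

record DiPath (G : Digraph) (n : ℕ) : Set where
  field
    vert  : Fin n → Fin (nV G)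
    inj   : Injective _≡_ _≡_ vert
    isEdge : ∀ (i j : Fin n) → toℕ j ≡ suc (toℕ i) → (vert i , vert j) ∈ edges G
open DiPath public

Monochromatic : {G : Digraph} {k n : ℕ} → Colouring G k → DiPath G n → Fin k → Set
Monochromatic χ P c = ∀ i j → toℕ j ≡ suc (toℕ i) → χ (vert P i) (vert P j) ≡ c

HasMonoPath : {G : Digraph} {k : ℕ} → Colouring G k → ℕ → Set
HasMonoPath {G} {k} χ n = Σ (DiPath G n) λ P → Σ (Fin k) λ c → Monochromatic χ P c

-- Give every vertex a vector label x v ∈ [M]^q, adjacent vertices receiving
-- different labels: a proper colouring with M^q colours, which exists as soon
-- as 2|E| < (M^q)².  Colour an edge (u , v) by the first coordinate i with
-- x u i < x v i, or by the extra colour q if there is none.  Along a path of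
-- colour i < q the coordinate x i increases; along a path of colour q the
-- labels decrease coordinatewise without repeating, so their total deficit
-- ∑ (M - 1 - x i) increases.  Hence every monochromatic path has at most
-- q (M - 1) + 1 vertices, and M ≈ n / q gives the bound.
module Submission where

open import Defs
open import Data.Empty using (⊥-elim)
open import Data.Fin as Fin using (Fin; zero; suc; toℕ; fromℕ<; inject≤; finToFun; funToFin)
import Data.Fin.Properties as Finₚ
open import Data.List as List using (List; []; _∷_; length; map; filter; allFin; tabulate)
import Data.List.Properties as Listₚ
open import Data.List.Membership.Propositional using (_∈_; _∉_)
open import Data.List.Membership.Propositional.Properties using (∈-filter⁺; ∈-allFin; ∈-map⁺)
open import Data.List.Relation.Unary.All as All using (All)
open import Data.List.Relation.Unary.Any as Any using (here; there)
open import Data.List.Relation.Unary.Any.Properties using (lookup-index)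
open import Data.Nat
  using (ℕ; zero; suc; _+_; _*_; _∸_; _^_; _<_; _≤_; pred; s≤s; z≤n; _≤?_; NonZero; >-nonZero⁻¹)
open import Data.Nat.DivMod using (_/_; _%_; m≡m%n+[m/n]*n; m%n<n; m/n*n≤m)
import Data.Nat.ListAction as ListAction
open import Data.Nat.Properties
open import Algebra.Properties.CommutativeMonoid.Sum +-0-commutativeMonoid
  using (sum; sum-syntax; ∑-distrib-+; sum-replicate-zero)
open import Data.Product using (Σ; _×_; _,_; proj₁; proj₂; ∃)
open import Data.Sum using (_⊎_; inj₁; inj₂)
open import Data.Vec as Vec using (Vec; []; _∷_; _∷ʳ_; lookup)
import Data.Vec.Properties as Vecₚ
open import Data.Vec.Functional using (Vector; updateAt)
open import Data.Vec.Functional.Properties using (updateAt-updates; updateAt-minimal)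
open import Data.Vec.Relation.Binary.Pointwise.Inductive using (Pointwise; []; _∷_)
open import Function using (id; _∘_; const)
open import Relation.Binary.PropositionalEquality
open import Relation.Nullary using (¬_; yes; no)

∑-mono-≤ : ∀ {n} {f g : Vector ℕ n} → (∀ i → f i ≤ g i) → sum f ≤ sum g
∑-mono-≤ {zero} f≤g = z≤n
∑-mono-≤ {suc n} f≤g = +-mono-≤ (f≤g zero) (∑-mono-≤ (f≤g ∘ suc))

sum-tabulate : ∀ {n} (f : Fin n → ℕ) → ListAction.sum (tabulate f) ≡ sum f
sum-tabulate {zero} f = refl
sum-tabulate {suc n} f = cong (f zero +_) (sum-tabulate (f ∘ suc))

length-filter-≥*≤sum : ∀ {A : Set} (f : A → ℕ) K (xs : List A) →
  length (filter (λ x → K ≤? f x) xs) * K ≤ ListAction.sum (map f xs)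
length-filter-≥*≤sum f K [] = z≤n
length-filter-≥*≤sum f K (x ∷ xs) with K ≤? f x
... | yes K≤fx rewrite Listₚ.filter-accept (λ x → K ≤? f x) {xs = xs} K≤fx =
  +-mono-≤ K≤fx (length-filter-≥*≤sum f K xs)
... | no K≰fx rewrite Listₚ.filter-reject (λ x → K ≤? f x) {xs = xs} K≰fx =
  ≤-trans (length-filter-≥*≤sum f K xs) (m≤n+m _ (f x))

δ : ∀ {n} → Fin n → Fin n → ℕ
δ zero zero = 1
δ zero (suc _) = 0
δ (suc _) zero = 0
δ (suc a) (suc b) = δ a b

δ-diag : ∀ {n} (a : Fin n) → δ a a ≡ 1
δ-diag zero = refl
δ-diag (suc a) = δ-diag a

∑-δ : ∀ {n} (a : Fin n) → ∑[ v < n ] δ a v ≡ 1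
∑-δ {suc n} zero = cong suc (sum-replicate-zero n)
∑-δ {suc n} (suc a) = ∑-δ a

fresh : ∀ {n} (xs : List (Fin n)) → length xs < n → ∃ (_∉ xs)
fresh {n} xs |xs|<n = Finₚ.¬∀⟶∃¬ n (_∈ xs) (λ c → Any.any? (Finₚ._≟_ c) xs) covers-none
  where
  covers-none : ¬ (∀ c → c ∈ xs)
  covers-none covers with Finₚ.pigeonhole |xs|<n (Any.index ∘ covers)
  ... | i , j , i<j , same-index = Finₚ.<-irrefl i≡j i<j
    where
    i≡j : i ≡ j
    i≡j = trans (lookup-index (covers i))
                (trans (cong (List.lookup xs) same-index) (sym (lookup-index (covers j))))

module _ {V : ℕ} where

  addIf : Fin V → Fin V → Fin V → List (Fin V) → List (Fin V)
  addIf v x y ns with x Finₚ.≟ v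
  ... | yes _ = y ∷ ns
  ... | no _ = ns

  neighbours : List (Fin V × Fin V) → Fin V → List (Fin V)
  neighbours [] v = []
  neighbours ((a , b) ∷ es) v = addIf v a b (addIf v b a (neighbours es v))

  degree : List (Fin V × Fin V) → Fin V → ℕ
  degree es v = length (neighbours es v)

  addIf-here : ∀ v y ns → y ∈ addIf v v y ns
  addIf-here v y ns with v Finₚ.≟ v
  ... | yes _ = here refl
  ... | no v≢v = ⊥-elim (v≢v refl)

  addIf-there : ∀ {v z ns} x y → z ∈ ns → z ∈ addIf v x y ns
  addIf-there {v} x y z∈ns with x Finₚ.≟ v
  ... | yes _ = there z∈ns
  ... | no _ = z∈ns

  length-addIf : ∀ v x y ns → length (addIf v x y ns) ≤ δ x v + length ns
  length-addIf v x y ns with x Finₚ.≟ v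
  ... | yes refl = ≤-reflexive (cong (_+ length ns) (sym (δ-diag x)))
  ... | no _ = m≤n+m (length ns) (δ x v)

  target∈neighbours : ∀ {es u v} → (u , v) ∈ es → v ∈ neighbours es u
  target∈neighbours {(u , v) ∷ es} (here refl) = addIf-here u v _
  target∈neighbours {(a , b) ∷ es} (there e) = addIf-there a b (addIf-there b a (target∈neighbours e))

  source∈neighbours : ∀ {es u v} → (u , v) ∈ es → u ∈ neighbours es v
  source∈neighbours {(u , v) ∷ es} (here refl) = addIf-there u v (addIf-here v u _)
  source∈neighbours {(a , b) ∷ es} (there e) = addIf-there a b (addIf-there b a (source∈neighbours e))

  handshake : ∀ es → ∑[ v < V ] degree es v ≤ 2 * length es
  handshake [] = ≤-reflexive (sum-replicate-zero V)
  handshake ((a , b) ∷ es) = begin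
    ∑[ v < V ] degree ((a , b) ∷ es) v
      ≤⟨ ∑-mono-≤ degree-∷ ⟩
    ∑[ v < V ] (δ a v + (δ b v + degree es v))
      ≡⟨ ∑-distrib-+ (δ a) _ ⟩
    ∑[ v < V ] δ a v + ∑[ v < V ] (δ b v + degree es v)
      ≡⟨ cong₂ _+_ (∑-δ a) (∑-distrib-+ (δ b) _) ⟩
    1 + (∑[ v < V ] δ b v + ∑[ v < V ] degree es v)
      ≡⟨ cong (λ s → 1 + (s + ∑[ v < V ] degree es v)) (∑-δ b) ⟩
    2 + ∑[ v < V ] degree es v
      ≤⟨ +-monoʳ-≤ 2 (handshake es) ⟩
    2 + 2 * length es
      ≡⟨ *-distribˡ-+ 2 1 (length es) ⟨
    2 * length ((a , b) ∷ es) ∎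
    where
    open ≤-Reasoning
    degree-∷ : ∀ v → degree ((a , b) ∷ es) v ≤ δ a v + (δ b v + degree es v)
    degree-∷ v = ≤-trans (length-addIf v a b _) (+-monoʳ-≤ (δ a v) (length-addIf v b a _))

-- Fewer than P vertices have degree ≥ P (handshake lemma); they get pairwise
-- distinct colours, and every other vertex is coloured greedily, avoiding the
-- colours of its fewer than P neighbours.
module SparseColouring {V : ℕ} (es : List (Fin V × Fin V))
  (loopless : All (λ e → proj₁ e ≢ proj₂ e) es)
  {P : ℕ} (sparse : 2 * length es < P * P) where

  High : Fin V → Set
  High v = P ≤ degree es v

  highs : List (Fin V)
  highs = filter (λ v → P ≤? degree es v) (allFin V)

  length-highs : length highs < P
  length-highs = *-cancelʳ-< P (length highs) P (begin-strict
    length highs * P                             ≤⟨ length-filter-≥*≤sum (degree es) P (allFin V) ⟩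
    ListAction.sum (map (degree es) (allFin V))  ≡⟨ cong ListAction.sum (Listₚ.map-tabulate id (degree es)) ⟩
    ListAction.sum (tabulate (degree es))        ≡⟨ sum-tabulate (degree es) ⟩
    ∑[ v < V ] degree es v                       ≤⟨ handshake es ⟩
    2 * length es                                <⟨ sparse ⟩
    P * P                                        ∎)
    where open ≤-Reasoning

  highLabel : ∀ {v} → High v → Fin P
  highLabel {v} hv = inject≤ (Any.index (∈-filter⁺ (λ v → P ≤? degree es v) (∈-allFin v) hv)) (<⇒≤ length-highs)

  highLabel-injective : ∀ {u v} (hu : High u) (hv : High v) → highLabel hu ≡ highLabel hv → u ≡ v
  highLabel-injective {u} {v} hu hv same = begin
    u                    ≡⟨ lookup-index (∈-filter⁺ _ (∈-allFin u) hu) ⟩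
    List.lookup highs _  ≡⟨ cong (List.lookup highs) (Finₚ.inject≤-injective _ _ _ _ same) ⟩
    List.lookup highs _  ≡⟨ lookup-index (∈-filter⁺ _ (∈-allFin v) hv) ⟨
    v                    ∎
    where open ≡-Reasoning

  ProperOn : (Fin V → Set) → (Fin V → Fin P) → Set
  ProperOn D lab = ∀ {u v} → (u , v) ∈ es → D u → D v → lab u ≢ lab v

  Coloured : List (Fin V) → Fin V → Set
  Coloured S v = High v ⊎ v ∈ S

  P>0 : 0 < P
  P>0 = n≢0⇒n>0 λ { refl → n≮0 sparse }

  initial : Σ (Fin V → Fin P) (ProperOn (Coloured []))
  initial = lab , proper
    where
    lab : Fin V → Fin P
    lab v with P ≤? degree es v
    ... | yes hv = highLabel hv
    ... | no _ = fromℕ< P>0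
    proper : ProperOn (Coloured []) lab
    proper {u} {v} e (inj₁ hu) (inj₁ hv) with P ≤? degree es u | P ≤? degree es v
    ... | yes hu′ | yes hv′ = All.lookup loopless e ∘ highLabel-injective hu′ hv′
    ... | no ¬hu | _ = ⊥-elim (¬hu hu)
    ... | _ | no ¬hv = ⊥-elim (¬hv hv)

  uncoloured : ∀ {S w x} → x ≢ w → Coloured (w ∷ S) x → Coloured S x
  uncoloured x≢w (inj₁ hx) = inj₁ hx
  uncoloured x≢w (inj₂ (here x≡w)) = ⊥-elim (x≢w x≡w)
  uncoloured x≢w (inj₂ (there x∈S)) = inj₂ x∈S

  recolour : ∀ {S lab w} c → (∀ {v} → v ∈ neighbours es w → lab v ≢ c) →
    ProperOn (Coloured S) lab → ProperOn (Coloured (w ∷ S)) (updateAt lab w (const c))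
  recolour {S} {lab} {w} c c-fresh proper {u} {v} e cu cv with u Finₚ.≟ w | v Finₚ.≟ w
  ... | yes refl | yes refl = λ _ → All.lookup loopless e refl
  ... | yes refl | no v≢w = λ same → c-fresh (target∈neighbours e)
    (trans (sym (updateAt-minimal v u lab v≢w)) (trans (sym same) (updateAt-updates u lab)))
  ... | no u≢w | yes refl = λ same → c-fresh (source∈neighbours e)
    (trans (sym (updateAt-minimal u v lab u≢w)) (trans same (updateAt-updates v lab)))
  ... | no u≢w | no v≢w = λ same → proper e (uncoloured u≢w cu) (uncoloured v≢w cv)
    (trans (sym (updateAt-minimal u w lab u≢w)) (trans same (updateAt-minimal v w lab v≢w)))

  freshColour : ∀ lab {w} → ¬ High w → ∃ λ c → ∀ {v} → v ∈ neighbours es w → lab v ≢ c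
  freshColour lab {w} low with fresh (map lab (neighbours es w))
                                     (subst (_< P) (sym (Listₚ.length-map lab (neighbours es w))) (≰⇒> low))
  ... | c , c∉ = c , λ v∈N lv≡c → c∉ (subst (_∈ map lab (neighbours es w)) lv≡c (∈-map⁺ lab v∈N))

  greedy : ∀ S → Σ (Fin V → Fin P) (ProperOn (Coloured S))
  greedy [] = initial
  greedy (w ∷ S) with greedy S | P ≤? degree es w
  ... | lab , proper | yes hw = lab , λ e cu cv → proper e (old cu) (old cv)
    where
    old : ∀ {x} → Coloured (w ∷ S) x → Coloured S x
    old (inj₁ hx) = inj₁ hx
    old (inj₂ (here refl)) = inj₁ hw
    old (inj₂ (there x∈S)) = inj₂ x∈S
  ... | lab , proper | no low with freshColour lab low
  ...   | c , c-fresh = updateAt lab w (const c) , recolour c c-fresh proper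

  properColouring : Σ (Fin V → Fin P) λ lab → ∀ {u v} → (u , v) ∈ es → lab u ≢ lab v
  properColouring with greedy (allFin V)
  ... | lab , proper = lab , λ {u} {v} e → proper e (inj₂ (∈-allFin u)) (inj₂ (∈-allFin v))

module _ {M : ℕ} where

  firstAscent : ∀ {q} → Vec (Fin M) q → Vec (Fin M) q → Fin (suc q)
  firstAscent [] [] = zero
  firstAscent (a ∷ as) (b ∷ bs) with a Finₚ.<? b
  ... | yes _ = zero
  ... | no _ = suc (firstAscent as bs)

  deficit : ∀ {q} → Vec (Fin M) q → ℕ
  deficit [] = 0
  deficit (a ∷ as) = (M ∸ suc (toℕ a)) + deficit as

  -- colour c < q is measured by coordinate c, the last colour q by the deficit
  potential : ∀ {q} → Fin (suc q) → Vec (Fin M) q → ℕ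
  potential c xs = lookup (Vec.map toℕ xs ∷ʳ deficit xs) c

  lookup-firstAscent-< : ∀ {q} (xs ys : Vec (Fin M) q) {d d′} → (Pointwise Fin._≥_ xs ys → d < d′) →
    lookup (Vec.map toℕ xs ∷ʳ d) (firstAscent xs ys) < lookup (Vec.map toℕ ys ∷ʳ d′) (firstAscent xs ys)
  lookup-firstAscent-< [] [] d<d′ = d<d′ []
  lookup-firstAscent-< (a ∷ as) (b ∷ bs) d<d′ with a Finₚ.<? b
  ... | yes a<b = a<b
  ... | no a≮b = lookup-firstAscent-< as bs (d<d′ ∘ (≮⇒≥ a≮b ∷_))

  deficit-mono-≤ : ∀ {q} {xs ys : Vec (Fin M) q} → Pointwise Fin._≥_ xs ys → deficit xs ≤ deficit ys
  deficit-mono-≤ [] = z≤n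
  deficit-mono-≤ (b≤a ∷ pw) = +-mono-≤ (∸-monoʳ-≤ M (s≤s b≤a)) (deficit-mono-≤ pw)

  deficit-mono-< : ∀ {q} {xs ys : Vec (Fin M) q} → Pointwise Fin._≥_ xs ys → xs ≢ ys → deficit xs < deficit ys
  deficit-mono-< [] []≢[] = ⊥-elim ([]≢[] refl)
  deficit-mono-< {xs = a ∷ as} {b ∷ bs} (b≤a ∷ pw) xs≢ys with a Finₚ.≟ b
  ... | yes refl = +-monoʳ-< (M ∸ suc (toℕ a)) (deficit-mono-< pw (xs≢ys ∘ cong (a ∷_)))
  ... | no a≢b = +-mono-<-≤ (∸-monoʳ-< (s≤s (Finₚ.≤∧≢⇒< b≤a (a≢b ∘ sym))) (Finₚ.toℕ<n a)) (deficit-mono-≤ pw)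

  potential-firstAscent-< : ∀ {q} {xs ys : Vec (Fin M) q} → xs ≢ ys →
    potential (firstAscent xs ys) xs < potential (firstAscent xs ys) ys
  potential-firstAscent-< {xs = xs} {ys} xs≢ys =
    lookup-firstAscent-< xs ys (λ xs≥ys → deficit-mono-< xs≥ys xs≢ys)

  deficit-≤ : ∀ {q} (xs : Vec (Fin M) q) → deficit xs ≤ q * pred M
  deficit-≤ [] = z≤n
  deficit-≤ (a ∷ as) = +-mono-≤ (≤-trans (∸-monoʳ-≤ M (s≤s z≤n)) (≤-reflexive (pred[m∸n]≡m∸[1+n] M 0)))
                                 (deficit-≤ as)

  lookup-∷ʳ-≤ : ∀ {q} c (xs : Vec (Fin M) q) {d B} → pred M ≤ B → d ≤ B → lookup (Vec.map toℕ xs ∷ʳ d) c ≤ B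
  lookup-∷ʳ-≤ zero [] pM≤B d≤B = d≤B
  lookup-∷ʳ-≤ zero (a ∷ as) pM≤B d≤B = ≤-trans (Finₚ.toℕ≤pred[n] a) pM≤B
  lookup-∷ʳ-≤ (suc c) (a ∷ as) pM≤B d≤B = lookup-∷ʳ-≤ c as pM≤B d≤B

  potential-≤ : ∀ {q} c (xs : Vec (Fin M) (suc q)) → potential c xs ≤ suc q * pred M
  potential-≤ c xs = lookup-∷ʳ-≤ c xs (m≤m+n (pred M) _) (deficit-≤ xs)

digits : ∀ {M q} → Fin (M ^ q) → Vec (Fin M) q
digits = Vec.tabulate ∘ finToFun

funToFin-cong : ∀ {m n} {f g : Fin m → Fin n} → f ≗ g → funToFin f ≡ funToFin g
funToFin-cong {zero} _ = refl
funToFin-cong {suc m} f≗g = cong₂ Fin.combine (f≗g zero) (funToFin-cong (f≗g ∘ suc))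

digits-injective : ∀ {M q} {i j : Fin (M ^ q)} → digits i ≡ digits j → i ≡ j
digits-injective {M} {q} {i} {j} same = begin
  i                              ≡⟨ Finₚ.funToFin-finToFin {q} {M} i ⟨
  funToFin (finToFun {M} {q} i)  ≡⟨ funToFin-cong same-digit ⟩
  funToFin (finToFun {M} {q} j)  ≡⟨ Finₚ.funToFin-finToFin {q} {M} j ⟩
  j                              ∎
  where
  open ≡-Reasoning
  same-digit : finToFun {M} {q} i ≗ finToFun j
  same-digit t = begin
    finToFun i t                 ≡⟨ Vecₚ.lookup∘tabulate (finToFun i) t ⟨
    lookup (digits i) t          ≡⟨ cong (λ xs → lookup xs t) same ⟩
    lookup (digits {q = q} j) t  ≡⟨ Vecₚ.lookup∘tabulate (finToFun j) t ⟩
    finToFun j t                 ∎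

increasing-potential⇒¬monochromatic : ∀ {G : Digraph} {k n} (χ : Colouring G k) (c : Fin k)
  (φ : Fin (nV G) → ℕ) → (∀ v → φ v < n) →
  (∀ {u v} → (u , v) ∈ edges G → χ u v ≡ c → φ u < φ v) →
  (P : DiPath G (suc n)) → ¬ Monochromatic χ P c
increasing-potential⇒¬monochromatic {n = n} χ c φ φ<n φ-increasing P mono =
  <-irrefl refl (<-≤-trans (φ<n _) (φ-along-path n ≤-refl))
  where
  φ-along-path : ∀ i (i<1+n : i < suc n) → i ≤ φ (vert P (fromℕ< i<1+n))
  φ-along-path zero _ = z≤n
  φ-along-path (suc i) 1+i<1+n =
    ≤-trans (s≤s (φ-along-path i i<1+n)) (φ-increasing (isEdge P _ _ step) (mono _ _ step))
    where
    i<1+n : i < suc n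
    i<1+n = <-trans (n<1+n i) 1+i<1+n
    step : toℕ (fromℕ< 1+i<1+n) ≡ suc (toℕ (fromℕ< i<1+n))
    step = trans (Finₚ.toℕ-fromℕ< 1+i<1+n) (cong suc (sym (Finₚ.toℕ-fromℕ< i<1+n)))

ascentColouring : ∀ (G : Digraph) q d → 2 * ∣E∣ G < suc d ^ suc q * suc d ^ suc q →
  ∀ n → suc q * d ≤ n → Σ (Colouring G (suc (suc q))) λ χ → ¬ HasMonoPath {G} χ (suc (suc n))
ascentColouring G q d sparse n qd≤n = χ , λ (P , c , mono) →
  increasing-potential⇒¬monochromatic χ c (potential c ∘ x)
    (λ v → s≤s (≤-trans (potential-≤ c (x v)) qd≤n)) (increasing c) P mono
  where
  open SparseColouring (edges G) (noLoops G) {suc d ^ suc q} sparse using (properColouring)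
  x : Fin (nV G) → Vec (Fin (suc d)) (suc q)
  x = digits ∘ proj₁ properColouring
  χ : Colouring G (suc (suc q))
  χ u v = firstAscent (x u) (x v)
  increasing : ∀ c {u v} → (u , v) ∈ edges G → χ u v ≡ c → potential c (x u) < potential c (x v)
  increasing c {u} {v} e refl =
    potential-firstAscent-< (proj₂ properColouring e ∘ digits-injective {suc d} {suc q})

^-distribʳ-* : ∀ m n k → (m * n) ^ k ≡ m ^ k * n ^ k
^-distribʳ-* m n zero = refl
^-distribʳ-* m n (suc k) = trans (cong (m * n *_) (^-distribʳ-* m n k)) ([m*n]*[o*p]≡[m*o]*[n*p] m n (m ^ k) (n ^ k))

few-edges⇒sparse : ∀ m n q M → m * (2 * (2 * q) ^ (2 * q)) < 1 * n ^ (2 * q) → n ≤ 2 * q * M →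
  2 * m < M ^ q * M ^ q
few-edges⇒sparse m n q M few n≤2qM = *-cancelʳ-< T (2 * m) (M ^ q * M ^ q) (begin-strict
  2 * m * T                  ≡⟨ trans (cong (_* T) (*-comm 2 m)) (*-assoc m 2 T) ⟩
  m * (2 * T)                <⟨ few ⟩
  1 * n ^ (2 * q)            ≡⟨ *-identityˡ _ ⟩
  n ^ (2 * q)                ≤⟨ ^-monoˡ-≤ (2 * q) n≤2qM ⟩
  (2 * q * M) ^ (2 * q)      ≡⟨ ^-distribʳ-* (2 * q) M (2 * q) ⟩
  T * M ^ (q + (q + 0))      ≡⟨ cong (λ e → T * M ^ (q + e)) (+-identityʳ q) ⟩
  T * M ^ (q + q)            ≡⟨ cong (T *_) (^-distribˡ-+-* M q q) ⟩
  T * (M ^ q * M ^ q)        ≡⟨ *-comm T _ ⟩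
  M ^ q * M ^ q * T          ∎)
  where
  open ≤-Reasoning
  T = (2 * q) ^ (2 * q)

2+n≤2q[1+n/q] : ∀ n q .{{_ : NonZero q}} → 2 + n ≤ 2 * q * suc (n / q)
2+n≤2q[1+n/q] n q = begin
  2 + n                              ≤⟨ s≤s n<qM ⟩
  1 + q * M                          ≤⟨ +-monoˡ-≤ (q * M) (*-mono-≤ (>-nonZero⁻¹ q) (s≤s z≤n)) ⟩
  q * M + q * M                      ≡⟨ cong (q * M +_) (+-identityʳ (q * M)) ⟨
  2 * (q * M)                        ≡⟨ *-assoc 2 q M ⟨
  2 * q * M                          ∎
  where
  open ≤-Reasoning
  M = suc (n / q)
  n<qM : n < q * M
  n<qM = begin-strict
    n                  ≡⟨ m≡m%n+[m/n]*n n q ⟩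
    n % q + n / q * q  <⟨ +-monoˡ-< (n / q * q) (m%n<n n q) ⟩
    q + n / q * q      ≡⟨ cong (q +_) (*-comm (n / q) q) ⟩
    q + q * (n / q)    ≡⟨ *-suc q (n / q) ⟨
    q * suc (n / q)    ∎

proposition4 : (q : ℕ) → 1 ≤ q →
    Σ ℕ λ a → Σ ℕ λ b → (1 ≤ a) × (1 ≤ b) ×
    ((n : ℕ) → 2 ≤ n → (G : Digraph) → ∣E∣ G * b < a * n ^ (2 * q) →
    Σ (Colouring G (suc q)) λ χ → ¬ HasMonoPath {G} χ n)
proposition4 q@(suc q′) _ =
  1 , 2 * (2 * q) ^ (2 * q) , s≤s z≤n , *-mono-≤ {1} {2} (s≤s z≤n) (m^n>0 (2 * q) (2 * q)) ,
  λ where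
    (suc (suc k)) (s≤s (s≤s _)) G few →
      ascentColouring G q′ (k / q)
        (few-edges⇒sparse (∣E∣ G) (2 + k) q (suc (k / q)) few (2+n≤2q[1+n/q] k q))
        k (≤-trans (≤-reflexive (*-comm q (k / q))) (m/n*n≤m k q))
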